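{- Let $M(2)$ be the graph with two vertices $1,2$ joined by an edge. Let $b\ge0$ and let $\mathcal{F}$ be a finite nonempty family of permutations of the vertices of $M(2)$ with $b$ blank spaces. Then \[ \alpha(H_{\mathcal{F},M(2)}) > \frac14\,|\mathcal{F}|. \]
   Context: For a finite graph $G$ with $n$ vertices and an integer $b\ge 0$, a permutation of the vertices of $G$ with $b$ blank spaces is a sequence of length $n+b$ in which every vertex of $G$ appears exactly once and the remaining $b$ entries are a blank symbol $*$. Two such sequences $\pi,\sigma$ are $G$-different if there is a position $i$ such that $\pi(i),\sigma(i)$ are both vertices and $\{\pi(i),\sigma(i)\}$ is an edge of $G$. For a family $\mathcal{F}$ of such sequences (all of the same length), $H_{\mathcal{F},G}$ is the graph whose vertices are the members of $\mathcal{F}$ and in which two members are adjacent iff they are $G$-different. $\alpha$ denotes the independence number. -}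

module Defs where

open import Data.Nat using (ℕ; _+_; _*_; _<_)
open import Data.Fin using (Fin; zero; suc)
open import Data.Maybe using (Maybe; just; nothing)
open import Data.List using (List; length)
open import Data.List.Membership.Propositional using (_∈_)
open import Data.List.Relation.Unary.Unique.Propositional using (Unique)
open import Data.List.Relation.Binary.Subset.Propositional using (_⊆_)
open import Data.Product using (Σ; ∃; _×_)
open import Data.Empty using (⊥)
open import Relation.Binary.PropositionalEquality using (_≡_)
open import Relation.Nullary using (¬_)

record Graph (n : ℕ) : Set₁ where
  field
    Adj       : Fin n → Fin n → Set
    irrefl    : ∀ {u} → ¬ Adj u u
    symmetric : ∀ {u v} → Adj u v → Adj v u
open Graph public

M2-Adj : Fin 2 → Fin 2 → Set
M2-Adj zero    zero          = ⊥
M2-Adj zero    (suc zero)    = Fin 1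
M2-Adj (suc zero) zero       = Fin 1
M2-Adj (suc zero) (suc zero) = ⊥

M2 : Graph 2
M2 = record { Adj = M2-Adj ; irrefl = irr ; symmetric = sym' }
  where
  irr : ∀ {u} → ¬ M2-Adj u u
  irr {zero} ()
  irr {suc zero} ()
  sym' : ∀ {u v} → M2-Adj u v → M2-Adj v u
  sym' {zero} {suc zero} e = e
  sym' {suc zero} {zero} e = e
  sym' {zero} {zero} ()
  sym' {suc zero} {suc zero} ()

-- A sequence of length n + b whose entries are vertices (just v) or blanks (nothing).
Seq : ℕ → ℕ → Set
Seq n b = Fin (n + b) → Maybe (Fin n)

-- It is a permutation of the vertices with b blank spaces if every vertex
-- appears exactly once (the remaining b entries are then blanks).
IsBlankPerm : ∀ {n b} → Seq n b → Set
IsBlankPerm {n} {b} π =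
  ∀ (v : Fin n) → Σ (Fin (n + b)) λ i →
    (π i ≡ just v) × (∀ j → π j ≡ just v → j ≡ i)

GDifferent : ∀ {n b} → Graph n → Seq n b → Seq n b → Set
GDifferent {n} {b} G π σ =
  Σ (Fin (n + b)) λ i → Σ (Fin n) λ u → Σ (Fin n) λ v →
    (π i ≡ just u) × (σ i ≡ just v) × Adj G u v

IsFamily : ∀ {n b} → List (Seq n b) → Set
IsFamily F = Unique F × (∀ {π} → π ∈ F → IsBlankPerm π)

-- S is an independent set of H_{F,G}: a duplicate-free sub-collection of F
-- no two members of which are G-different (adjacent in H_{F,G}).
IsIndependent : ∀ {n b} → Graph n → List (Seq n b) → List (Seq n b) → Set
IsIndependent G F S =
  Unique S × S ⊆ F × (∀ {π σ} → π ∈ S → σ ∈ S → ¬ GDifferent G π σ)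

-- α(H_{F,G}) > |F| / 4, i.e. some independent set S has 4·|S| > |F|.
αGreaterQuarter : ∀ {n b} → Graph n → List (Seq n b) → Set
αGreaterQuarter G F = Σ _ λ S → IsIndependent G F S × (length F < 4 * length S)

module Submission where

-- Idea (a random 2-colouring of the positions, derandomised by averaging).  Colour every position true/false.  Say that π *fits* the
-- colouring c if vertex 1 of π sits on a true position and vertex 2 on a false
-- one.  Two fitting sequences are never M(2)-different: a position holding 1
-- in one and 2 in the other would have to be both true and false.  Hence the
-- fitting members of a family F form an independent set of H_{F,M(2)}.
--
-- For a fixed π exactly a quarter of the 2^(2+b) colourings fit it, so summed
-- over all colourings, 4 · #(fitting members) totals 2^(2+b) · |F|: the average
-- of 4 · #fitting is exactly |F|.  The all-false colouring fits nothing, so it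
-- is strictly below average when F ≠ [], and therefore some colouring is
-- strictly above average, i.e. 4 · #fitting > |F|.

open import Defs
open import Data.Nat using (ℕ; _>_; zero)
open import Data.List using (List; length)

open import Data.Nat using (suc; _+_; _*_; _^_; _<_)
open import Data.Nat.Properties
open import Algebra.Properties.CommutativeSemigroup +-commutativeSemigroup using (interchange)
open import Data.Bool using (Bool; true; false; not; T)
open import Data.Fin using (Fin) renaming (zero to fzero; suc to fsuc)
open import Data.Fin.Properties using (all?)
open import Data.Vec using (Vec; []; _∷_; lookup; replicate)
open import Data.Vec.Properties using (lookup-replicate)
open import Data.Maybe using (Maybe; just; nothing)
open import Data.List using ([]; _∷_; filter)
open import Data.List.Properties using (filter-none)
open import Data.List.Relation.Unary.All using (tabulate)
open import Data.List.Relation.Unary.Any using (here; there)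
open import Data.List.Membership.Propositional using (_∈_)
open import Data.List.Membership.Propositional.Properties using (∈-filter⁻)
open import Data.List.Relation.Unary.Unique.Propositional.Properties using (filter⁺)
open import Data.List.Relation.Binary.Subset.Propositional.Properties using (filter-⊆)
open import Data.Product using (∃; _,_; proj₁; proj₂)
open import Data.Unit using (⊤; tt)
open import Data.Empty using (⊥; ⊥-elim)
open import Relation.Nullary using (¬_; Dec; yes; no)
open import Relation.Nullary.Decidable using (T?)
open import Relation.Binary.Definitions using (tri<; tri≈; tri>)
open import Relation.Binary.PropositionalEquality
open import Function using (_∘_)

Colouring : ℕ → Set
Colouring N = Vec Bool N

sumAll : ∀ N → (Colouring N → ℕ) → ℕ
sumAll zero    g = g []
sumAll (suc N) g = sumAll N (λ c → g (true ∷ c)) + sumAll N (λ c → g (false ∷ c))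

-- Pointwise equal summands have equal sums (there is no function extensionality).
sumAll-cong : ∀ N {g h : Colouring N → ℕ} → (∀ c → g c ≡ h c) → sumAll N g ≡ sumAll N h
sumAll-cong zero    g≡h = g≡h []
sumAll-cong (suc N) g≡h =
  cong₂ _+_ (sumAll-cong N (λ c → g≡h (true ∷ c))) (sumAll-cong N (λ c → g≡h (false ∷ c)))

sumAll-+ : ∀ N (g h : Colouring N → ℕ) →
  sumAll N (λ c → g c + h c) ≡ sumAll N g + sumAll N h
sumAll-+ zero    g h = refl
sumAll-+ (suc N) g h = begin
  sumAll N (λ c → g (true ∷ c) + h (true ∷ c)) + sumAll N (λ c → g (false ∷ c) + h (false ∷ c))
    ≡⟨ cong₂ _+_ (sumAll-+ N _ _) (sumAll-+ N _ _) ⟩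
  (sumAll N (λ c → g (true ∷ c)) + sumAll N (λ c → h (true ∷ c)))
    + (sumAll N (λ c → g (false ∷ c)) + sumAll N (λ c → h (false ∷ c)))
    ≡⟨ interchange (sumAll N (λ c → g (true ∷ c))) (sumAll N (λ c → h (true ∷ c)))
                   (sumAll N (λ c → g (false ∷ c))) (sumAll N (λ c → h (false ∷ c))) ⟩
  sumAll (suc N) g + sumAll (suc N) h ∎
  where open ≡-Reasoning

sumAll-scale : ∀ N k (g : Colouring N → ℕ) → sumAll N (λ c → k * g c) ≡ k * sumAll N g
sumAll-scale zero    k g = refl
sumAll-scale (suc N) k g =
  trans (cong₂ _+_ (sumAll-scale N k _) (sumAll-scale N k _)) (sym (*-distribˡ-+ k _ _))

halves : ∀ N t → 2 ^ N * t + 2 ^ N * t ≡ 2 ^ suc N * t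
halves N t = sym (trans (*-assoc 2 (2 ^ N) t) (cong (2 ^ N * t +_) (+-identityʳ (2 ^ N * t))))

sumAll-const : ∀ N t → sumAll N (λ _ → t) ≡ 2 ^ N * t
sumAll-const zero    t = sym (*-identityˡ t)
sumAll-const (suc N) t = trans (cong₂ _+_ (sumAll-const N t) (sumAll-const N t)) (halves N t)

sumAll-one : ∀ N (p : Fin (suc N)) (f : Bool → ℕ) →
  sumAll (suc N) (λ c → f (lookup c p)) ≡ 2 ^ N * (f true + f false)
sumAll-one N fzero f =
  trans (cong₂ _+_ (sumAll-const N (f true)) (sumAll-const N (f false)))
        (sym (*-distribˡ-+ (2 ^ N) (f true) (f false)))
sumAll-one (suc N) (fsuc p) f =
  trans (cong₂ _+_ (sumAll-one N p f) (sumAll-one N p f)) (halves N _)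

sumAll-two : ∀ N (p q : Fin (2 + N)) → p ≢ q → (f : Bool → Bool → ℕ) →
  sumAll (2 + N) (λ c → f (lookup c p) (lookup c q))
    ≡ 2 ^ N * ((f true true + f true false) + (f false true + f false false))
sumAll-two N fzero fzero p≢q f = ⊥-elim (p≢q refl)
sumAll-two N fzero (fsuc q) _ f =
  trans (cong₂ _+_ (sumAll-one N q (f true)) (sumAll-one N q (f false)))
        (sym (*-distribˡ-+ (2 ^ N) _ _))
sumAll-two N (fsuc p) fzero _ f = begin
  sumAll (suc N) (λ c → f (lookup c p) true) + sumAll (suc N) (λ c → f (lookup c p) false)
    ≡⟨ cong₂ _+_ (sumAll-one N p (λ x → f x true)) (sumAll-one N p (λ x → f x false)) ⟩
  2 ^ N * (f true true + f false true) + 2 ^ N * (f true false + f false false)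
    ≡⟨ sym (*-distribˡ-+ (2 ^ N) _ _) ⟩
  2 ^ N * ((f true true + f false true) + (f true false + f false false))
    ≡⟨ cong (2 ^ N *_) (interchange (f true true) (f false true) (f true false) (f false false)) ⟩
  2 ^ N * ((f true true + f true false) + (f false true + f false false)) ∎
  where open ≡-Reasoning
sumAll-two zero    (fsuc fzero) (fsuc fzero) p≢q f = ⊥-elim (p≢q refl)
sumAll-two (suc N) (fsuc p)     (fsuc q)     p≢q f =
  trans (cong₂ _+_ (sumAll-two N p q p≢q′ f) (sumAll-two N p q p≢q′ f)) (halves N _)
  where
  p≢q′ : p ≢ q
  p≢q′ p≡q = p≢q (cong fsuc p≡q)

sumAll-halves : ∀ N (g : Colouring (suc N) → ℕ) x →
  sumAll (suc N) g ≡ sumAll N (λ c → g (x ∷ c)) + sumAll N (λ c → g (not x ∷ c))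
sumAll-halves N g true  = refl
sumAll-halves N g false = +-comm (sumAll N (λ c → g (true ∷ c))) (sumAll N (λ c → g (false ∷ c)))

above-average : ∀ N (g : Colouring N → ℕ) m → 2 ^ N * m < sumAll N g → ∃ λ c → m < g c
above-average zero    g m m<g = [] , subst (_< g []) (*-identityˡ m) m<g
above-average (suc N) g m m<g with 2 ^ N * m <? sumAll N (λ c → g (true ∷ c))
... | yes m<left = let c , m<gc = above-average N _ m m<left in true ∷ c , m<gc
... | no  m≮left = let c , m<gc = above-average N _ m m<right in false ∷ c , m<gc
  where
  open ≤-Reasoning
  m<right : 2 ^ N * m < sumAll N (λ c → g (false ∷ c))
  m<right = +-cancelˡ-< (sumAll N (λ c → g (true ∷ c))) _ _ (begin-strict
    sumAll N (λ c → g (true ∷ c)) + 2 ^ N * m ≤⟨ +-monoˡ-≤ _ (≮⇒≥ m≮left) ⟩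
    2 ^ N * m + 2 ^ N * m                      ≡⟨ halves N m ⟩
    2 ^ suc N * m                              <⟨ m<g ⟩
    sumAll (suc N) g                           ∎)

averaging : ∀ N (g : Colouring N → ℕ) m → sumAll N g ≡ 2 ^ N * m →
  (c₀ : Colouring N) → g c₀ < m → ∃ λ c → m < g c
averaging zero g m total [] low =
  ⊥-elim (<-irrefl (trans total (*-identityˡ m)) low)
averaging (suc N) g m total (x ∷ c₀) low with <-cmp (sumAll N (λ c → g (x ∷ c))) (2 ^ N * m)
... | tri≈ _ half≡ _ = let c , m<gc = averaging N _ m half≡ c₀ low in x ∷ c , m<gc
... | tri> _ _ m<half = let c , m<gc = above-average N _ m m<half in x ∷ c , m<gc
... | tri< half<m _ _ = let c , m<gc = above-average N _ m m<other in not x ∷ c , m<gc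
  where
  open ≤-Reasoning
  m<other : 2 ^ N * m < sumAll N (λ c → g (not x ∷ c))
  m<other = +-cancelˡ-< (sumAll N (λ c → g (x ∷ c))) _ _ (begin-strict
    sumAll N (λ c → g (x ∷ c)) + 2 ^ N * m                  <⟨ +-monoˡ-< _ half<m ⟩
    2 ^ N * m + 2 ^ N * m                                   ≡⟨ halves N m ⟩
    2 ^ suc N * m                                           ≡⟨ total ⟨
    sumAll (suc N) g                                        ≡⟨ sumAll-halves N g x ⟩
    sumAll N (λ c → g (x ∷ c)) + sumAll N (λ c → g (not x ∷ c)) ∎)

Allowed : Maybe (Fin 2) → Bool → Set
Allowed (just fzero)        x = T x
Allowed (just (fsuc fzero)) x = T (not x)
Allowed nothing             x = ⊤

allowed? : ∀ e x → Dec (Allowed e x)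
allowed? (just fzero)        x = T? x
allowed? (just (fsuc fzero)) x = T? (not x)
allowed? nothing             x = yes tt

Fits : ∀ {b} → Colouring (2 + b) → Seq 2 b → Set
Fits c π = ∀ i → Allowed (π i) (lookup c i)

fits? : ∀ {b} (c : Colouring (2 + b)) (π : Seq 2 b) → Dec (Fits c π)
fits? c π = all? (λ i → allowed? (π i) (lookup c i))

Fitting : ∀ {b} → Colouring (2 + b) → List (Seq 2 b) → List (Seq 2 b)
Fitting c F = filter (fits? c) F

fits-not-different : ∀ {b} (c : Colouring (2 + b)) {π σ : Seq 2 b} →
  Fits c π → Fits c σ → ¬ GDifferent M2 π σ
fits-not-different c {π} {σ} fits-π fits-σ (i , u , v , πi≡u , σi≡v , u~v) =
  clash u v u~v (subst (λ e → Allowed e (lookup c i)) πi≡u (fits-π i))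
                (subst (λ e → Allowed e (lookup c i)) σi≡v (fits-σ i))
  where
  clash : ∀ u v {x} → Adj M2 u v → Allowed (just u) x → Allowed (just v) x → ⊥
  clash fzero        (fsuc fzero) {true}  _ _ ()
  clash fzero        (fsuc fzero) {false} _ () _
  clash (fsuc fzero) fzero        {true}  _ () _
  clash (fsuc fzero) fzero        {false} _ _ ()
  clash fzero        fzero        ()
  clash (fsuc fzero) (fsuc fzero) ()

position : ∀ {b} {π : Seq 2 b} → IsBlankPerm π → Fin 2 → Fin (2 + b)
position perm v = proj₁ (perm v)

cut : Bool → Bool → ℕ
cut true false = 1
cut _    _     = 0

indicator : ∀ {A : Set} → Dec A → ℕ
indicator (yes _) = 1
indicator (no _)  = 0

fits-indicator : ∀ {b} (c : Colouring (2 + b)) {π : Seq 2 b} (perm : IsBlankPerm π) →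
  indicator (fits? c π) ≡ cut (lookup c (position perm fzero)) (lookup c (position perm (fsuc fzero)))
fits-indicator c {π} perm with fits? c π
... | yes fits = sym (fitting-cut _ _ (allowed-at fzero fits) (allowed-at (fsuc fzero) fits))
  where
  allowed-at : ∀ v → Fits c π → Allowed (just v) (lookup c (position perm v))
  allowed-at v fits =
    subst (λ e → Allowed e (lookup c (position perm v))) (proj₁ (proj₂ (perm v))) (fits (position perm v))
  fitting-cut : ∀ x y → T x → T (not y) → cut x y ≡ 1
  fitting-cut true false _ _ = refl
... | no ¬fits = sym (unfit-cut _ _ (λ one-true two-false → ¬fits (fits-from one-true two-false)))
  where
  unfit-cut : ∀ x y → (T x → T (not y) → ⊥) → cut x y ≡ 0
  unfit-cut true  true  _ = refl
  unfit-cut true  false h = ⊥-elim (h tt tt)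
  unfit-cut false y     _ = refl
  at-position : ∀ v i → π i ≡ just v → lookup c i ≡ lookup c (position perm v)
  at-position v i πi≡v = cong (lookup c) (proj₂ (proj₂ (perm v)) i πi≡v)
  fits-from : T (lookup c (position perm fzero)) → T (not (lookup c (position perm (fsuc fzero)))) →
    Fits c π
  fits-from one-true two-false i with π i in πi
  ... | just fzero        = subst T (sym (at-position fzero i πi)) one-true
  ... | just (fsuc fzero) = subst (T ∘ not) (sym (at-position (fsuc fzero) i πi)) two-false
  ... | nothing           = tt

positions-differ : ∀ {b} {π : Seq 2 b} (perm : IsBlankPerm π) →
  position perm fzero ≢ position perm (fsuc fzero)
positions-differ {π = π} perm same with
  trans (sym (proj₁ (proj₂ (perm fzero)))) (trans (cong π same) (proj₁ (proj₂ (perm (fsuc fzero)))))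
... | ()

fitting-colourings : ∀ b {π : Seq 2 b} → IsBlankPerm π →
  sumAll (2 + b) (λ c → indicator (fits? c π)) ≡ 2 ^ b
fitting-colourings b {π} perm = begin
  sumAll (2 + b) (λ c → indicator (fits? c π))
    ≡⟨ sumAll-cong (2 + b) (λ c → fits-indicator c perm) ⟩
  sumAll (2 + b) (λ c → cut (lookup c (position perm fzero)) (lookup c (position perm (fsuc fzero))))
    ≡⟨ sumAll-two b _ _ (positions-differ perm) cut ⟩
  2 ^ b * 1
    ≡⟨ *-identityʳ (2 ^ b) ⟩
  2 ^ b ∎
  where open ≡-Reasoning

filter-length-∷ : ∀ {A : Set} {P : A → Set} (P? : ∀ x → Dec (P x)) x xs →
  length (filter P? (x ∷ xs)) ≡ indicator (P? x) + length (filter P? xs)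
filter-length-∷ P? x xs with P? x
... | yes _ = refl
... | no  _ = refl

fitting-total : ∀ b (F : List (Seq 2 b)) → (∀ {π} → π ∈ F → IsBlankPerm π) →
  sumAll (2 + b) (λ c → length (Fitting c F)) ≡ 2 ^ b * length F
fitting-total b []      _     =
  trans (sumAll-const (2 + b) 0) (trans (*-zeroʳ (2 ^ (2 + b))) (sym (*-zeroʳ (2 ^ b))))
fitting-total b (π ∷ F) perms = begin
  sumAll (2 + b) (λ c → length (Fitting c (π ∷ F)))
    ≡⟨ sumAll-cong (2 + b) (λ c → filter-length-∷ (fits? c) π F) ⟩
  sumAll (2 + b) (λ c → indicator (fits? c π) + length (Fitting c F))
    ≡⟨ sumAll-+ (2 + b) (λ c → indicator (fits? c π)) (λ c → length (Fitting c F)) ⟩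
  sumAll (2 + b) (λ c → indicator (fits? c π)) + sumAll (2 + b) (λ c → length (Fitting c F))
    ≡⟨ cong₂ _+_ (fitting-colourings b (perms (here refl))) (fitting-total b F (perms ∘ there)) ⟩
  2 ^ b + 2 ^ b * length F
    ≡⟨ *-suc (2 ^ b) (length F) ⟨
  2 ^ b * length (π ∷ F) ∎
  where open ≡-Reasoning

-- Nothing fits the all-false colouring, since vertex 1 needs a true position.
all-false-fits-nothing : ∀ b (F : List (Seq 2 b)) → (∀ {π} → π ∈ F → IsBlankPerm π) →
  Fitting (replicate (2 + b) false) F ≡ []
all-false-fits-nothing b F perms = filter-none (fits? all-false) (tabulate unfit)
  where
  all-false : Colouring (2 + b)
  all-false = replicate (2 + b) false
  unfit : ∀ {π} → π ∈ F → ¬ Fits all-false π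
  unfit π∈F fits with perms π∈F fzero
  ... | p , πp≡1 , _ = subst T (lookup-replicate p false)
                              (subst (λ e → Allowed e (lookup all-false p)) πp≡1 (fits p))

good-colouring : ∀ b (F : List (Seq 2 b)) → (∀ {π} → π ∈ F → IsBlankPerm π) → length F > zero →
  ∃ λ c → length F < 4 * length (Fitting c F)
good-colouring b F perms nonempty =
  averaging (2 + b) (λ c → 4 * length (Fitting c F)) (length F) average
            (replicate (2 + b) false) below
  where
  open ≡-Reasoning
  average : sumAll (2 + b) (λ c → 4 * length (Fitting c F)) ≡ 2 ^ (2 + b) * length F
  average = begin
    sumAll (2 + b) (λ c → 4 * length (Fitting c F)) ≡⟨ sumAll-scale (2 + b) 4 (λ c → length (Fitting c F)) ⟩
    4 * sumAll (2 + b) (λ c → length (Fitting c F)) ≡⟨ cong (4 *_) (fitting-total b F perms) ⟩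
    4 * (2 ^ b * length F)                          ≡⟨ *-assoc 4 (2 ^ b) (length F) ⟨
    4 * 2 ^ b * length F                            ≡⟨ cong (_* length F) (*-assoc 2 2 (2 ^ b)) ⟩
    2 ^ (2 + b) * length F                          ∎
  below : 4 * length (Fitting (replicate (2 + b) false) F) < length F
  below = subst (λ S → 4 * length S < length F) (sym (all-false-fits-nothing b F perms)) nonempty

corollary3 : (b : ℕ) (F : List (Seq 2 b)) →
    IsFamily F → length F > zero → αGreaterQuarter M2 F
corollary3 b F (unique , perms) nonempty =
  Fitting c F , (filter⁺ (fits? c) unique , filter-⊆ (fits? c) F , independent) , large
  where
  c : Colouring (2 + b)
  c = proj₁ (good-colouring b F perms nonempty)
  large : length F < 4 * length (Fitting c F)
  large = proj₂ (good-colouring b F perms nonempty)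
  independent : ∀ {π σ} → π ∈ Fitting c F → σ ∈ Fitting c F → ¬ GDifferent M2 π σ
  independent π∈S σ∈S =
    fits-not-different c (proj₂ (∈-filter⁻ (fits? c) {xs = F} π∈S)) (proj₂ (∈-filter⁻ (fits? c) {xs = F} σ∈S))
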